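{- Let $\mathcal{A}$ be any simply closed set of Left dead-ends (i.e., closed under taking options and under disjunctive sum). Then $\mathcal{D}(\mathcal{A})\cap\mathcal{L}=\mathcal{A}$.
   Context: Games are finite partizan games $\{\mathscr{G}^L\mid\mathscr{G}^R\}$; disjunctive sum $G+H=\{G^L+H,G+H^L\mid G^R+H,G+H^R\}$; conjugate $\overline{G}=\{\overline{G^R}\mid\overline{G^L}\}$. A universe is a set of games closed under taking options, under sums, under conjugation, and under forming $\{\mathscr{S}\mid\mathscr{T}\}$ for nonempty finite subsets $\mathscr{S},\mathscr{T}$ of it. $\mathcal{D}(\mathcal{A})$ is the smallest universe containing $\mathcal{A}$. A Left dead-end is a game all of whose subpositions have no Left option; $\mathcal{L}$ is the set of Left dead-ends. -}

module Defs where

open import Level using (Level; _⊔_) renaming (suc to lsuc; zero to lzero)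
open import Data.List using (List; []; _∷_; _++_)
open import Data.List.NonEmpty using (List⁺; toList)
open import Data.List.Relation.Unary.All using (All)
open import Data.List.Relation.Unary.Any using (Any)
open import Data.List.Membership.Propositional using (_∈_)
open import Data.Product using (_×_)
open import Relation.Binary.PropositionalEquality using (_≡_)

data Game : Set where
  ⟨_∣_⟩ : List Game → List Game → Game

leftOpts : Game → List Game
leftOpts ⟨ L ∣ R ⟩ = L

rightOpts : Game → List Game
rightOpts ⟨ L ∣ R ⟩ = R

-- Identity of game forms: option lists are compared as (finite) sets,
-- recursively (so order and repetitions of options are irrelevant).
data _≅_ : Game → Game → Set where
  iso : ∀ {GL GR HL HR} →
        All (λ x → Any (λ y → x ≅ y) HL) GL →
        All (λ y → Any (λ x → x ≅ y) GL) HL →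
        All (λ x → Any (λ y → x ≅ y) HR) GR →
        All (λ y → Any (λ x → x ≅ y) GR) HR →
        ⟨ GL ∣ GR ⟩ ≅ ⟨ HL ∣ HR ⟩

mutual
  _+_ : Game → Game → Game
  G@(⟨ GL ∣ GR ⟩) + H@(⟨ HL ∣ HR ⟩) =
    ⟨ addL GL H ++ addR G HL ∣ addL GR H ++ addR G HR ⟩

  addL : List Game → Game → List Game
  addL [] H = []
  addL (g ∷ gs) H = (g + H) ∷ addL gs H

  addR : Game → List Game → List Game
  addR G [] = []
  addR G (h ∷ hs) = (G + h) ∷ addR G hs

infixl 6 _+_

mutual
  conj : Game → Game
  conj ⟨ L ∣ R ⟩ = ⟨ conjs R ∣ conjs L ⟩

  conjs : List Game → List Game
  conjs [] = []
  conjs (g ∷ gs) = conj g ∷ conjs gs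

data IsOption (H : Game) : Game → Set where
  leftOpt  : ∀ {L R} → H ∈ L → IsOption H ⟨ L ∣ R ⟩
  rightOpt : ∀ {L R} → H ∈ R → IsOption H ⟨ L ∣ R ⟩

data Subposition : Game → Game → Set where
  here  : ∀ {G} → Subposition G G
  there : ∀ {H K G} → Subposition H K → IsOption K G → Subposition H G

LeftDeadEnd : Game → Set
LeftDeadEnd G = ∀ H → Subposition H G → leftOpts H ≡ []

module _ {ℓ : Level} (U : Game → Set ℓ) where

  IsoClosed : Set ℓ
  IsoClosed = ∀ {G H} → G ≅ H → U G → U H

  OptionClosed : Set ℓ
  OptionClosed = ∀ {G H} → IsOption H G → U G → U H

  SumClosed : Set ℓ
  SumClosed = ∀ {G H} → U G → U H → U (G + H)

  ConjClosed : Set ℓ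
  ConjClosed = ∀ {G} → U G → U (conj G)

  FormClosed : Set ℓ
  FormClosed = ∀ (S T : List⁺ Game) → All U (toList S) → All U (toList T) →
               U ⟨ toList S ∣ toList T ⟩

  SimplyClosed : Set ℓ
  SimplyClosed = OptionClosed × SumClosed

  IsUniverse : Set ℓ
  IsUniverse = IsoClosed × OptionClosed × SumClosed × ConjClosed × FormClosed

D : (Game → Set) → Game → Set₁
D A G = ∀ (U : Game → Set) → IsUniverse U → (∀ {H} → A H → U H) → U G

-- Let 𝒰 be the set of games all of whose subpositions K satisfy: if K is a Left dead-end then
-- K ∈ A, and if the conjugate of K is a Left dead-end then conj K ∈ A.  It contains A, and it
-- is a universe: options and conjugates are immediate, a sum is a Left dead-end only if both
-- summands are (and A is closed under sums), and a form {S | T} with S, T nonempty has Left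
-- options, as does its conjugate.  Hence D(A) ⊆ 𝒰, and a Left dead-end in 𝒰 lies in A.
module Submission where

open import Defs
open import Data.Product using (_×_; _,_; proj₁; proj₂; ∃)
open import Data.Sum using (_⊎_; inj₁; inj₂)
open import Data.List using (List; []; _∷_; _++_; map)
open import Data.List.NonEmpty using () renaming (_∷_ to _∷⁺_)
open import Data.List.Relation.Unary.All using (All; []; _∷_; lookup)
open import Data.List.Relation.Unary.Any using (Any; here; there)
open import Data.List.Membership.Propositional using (_∈_; find)
open import Data.List.Membership.Propositional.Properties using (∈-map⁺; ∈-map⁻; ∈-++⁻; ∈-++⁺ˡ; ∈-++⁺ʳ)
open import Relation.Binary.PropositionalEquality using (_≡_; refl; sym; trans; cong; cong₂; subst)

addL≡map : ∀ gs H → addL gs H ≡ map (_+ H) gs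
addL≡map []       H = refl
addL≡map (g ∷ gs) H = cong (g + H ∷_) (addL≡map gs H)

addR≡map : ∀ G hs → addR G hs ≡ map (G +_) hs
addR≡map G []       = refl
addR≡map G (h ∷ hs) = cong (G + h ∷_) (addR≡map G hs)

∈-addL⁻ : ∀ {x} gs H → x ∈ addL gs H → ∃ λ g → g ∈ gs × x ≡ g + H
∈-addL⁻ gs H x∈ = ∈-map⁻ (_+ H) (subst (_ ∈_) (addL≡map gs H) x∈)

∈-addR⁻ : ∀ {x} G hs → x ∈ addR G hs → ∃ λ h → h ∈ hs × x ≡ G + h
∈-addR⁻ G hs x∈ = ∈-map⁻ (G +_) (subst (_ ∈_) (addR≡map G hs) x∈)

∈-addL⁺ : ∀ {g gs} H → g ∈ gs → g + H ∈ addL gs H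
∈-addL⁺ {gs = gs} H g∈ = subst (_ ∈_) (sym (addL≡map gs H)) (∈-map⁺ (_+ H) g∈)

∈-addR⁺ : ∀ {h hs} G → h ∈ hs → G + h ∈ addR G hs
∈-addR⁺ {hs = hs} G h∈ = subst (_ ∈_) (sym (addR≡map G hs)) (∈-map⁺ (G +_) h∈)

isOption-+⁻ : ∀ {K} G H → IsOption K (G + H) →
  (∃ λ g → IsOption g G × K ≡ g + H) ⊎ (∃ λ h → IsOption h H × K ≡ G + h)
isOption-+⁻ G@(⟨ GL ∣ GR ⟩) H@(⟨ HL ∣ HR ⟩) (leftOpt K∈) with ∈-++⁻ (addL GL H) K∈
... | inj₁ K∈′ = let g , g∈ , eq = ∈-addL⁻ GL H K∈′ in inj₁ (g , leftOpt g∈ , eq)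
... | inj₂ K∈′ = let h , h∈ , eq = ∈-addR⁻ G HL K∈′ in inj₂ (h , leftOpt h∈ , eq)
isOption-+⁻ G@(⟨ GL ∣ GR ⟩) H@(⟨ HL ∣ HR ⟩) (rightOpt K∈) with ∈-++⁻ (addL GR H) K∈
... | inj₁ K∈′ = let g , g∈ , eq = ∈-addL⁻ GR H K∈′ in inj₁ (g , rightOpt g∈ , eq)
... | inj₂ K∈′ = let h , h∈ , eq = ∈-addR⁻ G HR K∈′ in inj₂ (h , rightOpt h∈ , eq)

isOption-+ˡ : ∀ {K G} H → IsOption K G → IsOption (K + H) (G + H)
isOption-+ˡ {G = ⟨ GL ∣ GR ⟩} ⟨ HL ∣ HR ⟩ (leftOpt K∈)  = leftOpt (∈-++⁺ˡ (∈-addL⁺ _ K∈))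
isOption-+ˡ {G = ⟨ GL ∣ GR ⟩} ⟨ HL ∣ HR ⟩ (rightOpt K∈) = rightOpt (∈-++⁺ˡ (∈-addL⁺ _ K∈))

isOption-+ʳ : ∀ {K H} G → IsOption K H → IsOption (G + K) (G + H)
isOption-+ʳ {H = ⟨ HL ∣ HR ⟩} ⟨ GL ∣ GR ⟩ (leftOpt K∈)  = leftOpt (∈-++⁺ʳ (addL GL _) (∈-addR⁺ _ K∈))
isOption-+ʳ {H = ⟨ HL ∣ HR ⟩} ⟨ GL ∣ GR ⟩ (rightOpt K∈) = rightOpt (∈-++⁺ʳ (addL GR _) (∈-addR⁺ _ K∈))

subposition-+⁻ : ∀ {K} G H → Subposition K (G + H) →
  ∃ λ G′ → ∃ λ H′ → Subposition G′ G × Subposition H′ H × K ≡ G′ + H′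
subposition-+⁻ G H s = go s G H refl
  where
  go : ∀ {K J} → Subposition K J → ∀ G H → J ≡ G + H →
       ∃ λ G′ → ∃ λ H′ → Subposition G′ G × Subposition H′ H × K ≡ G′ + H′
  go here        G H eq = G , H , here , here , eq
  go (there s o) G H refl with isOption-+⁻ G H o
  ... | inj₁ (g , og , eq) = let G′ , H′ , sG , sH , eq′ = go s g H eq
                             in G′ , H′ , there sG og , sH , eq′
  ... | inj₂ (h , oh , eq) = let G′ , H′ , sG , sH , eq′ = go s G h eq
                             in G′ , H′ , sG , there sH oh , eq′

subposition-+ˡ : ∀ {K G} H → Subposition K G → Subposition (K + H) (G + H)
subposition-+ˡ H here        = here
subposition-+ˡ H (there s o) = there (subposition-+ˡ H s) (isOption-+ˡ H o)

subposition-+ʳ : ∀ {K H} G → Subposition K H → Subposition (G + K) (G + H)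
subposition-+ʳ G here        = here
subposition-+ʳ G (there s o) = there (subposition-+ʳ G s) (isOption-+ʳ G o)

noLeftOpts-+ˡ : ∀ G H → leftOpts (G + H) ≡ [] → leftOpts G ≡ []
noLeftOpts-+ˡ ⟨ [] ∣ GR ⟩ ⟨ HL ∣ HR ⟩ _ = refl

noLeftOpts-+ʳ : ∀ G H → leftOpts (G + H) ≡ [] → leftOpts H ≡ []
noLeftOpts-+ʳ ⟨ [] ∣ GR ⟩ ⟨ [] ∣ HR ⟩ _ = refl

LeftDeadEnd-+ˡ : ∀ G H → LeftDeadEnd (G + H) → LeftDeadEnd G
LeftDeadEnd-+ˡ G H l J s = noLeftOpts-+ˡ J H (l (J + H) (subposition-+ˡ H s))

LeftDeadEnd-+ʳ : ∀ G H → LeftDeadEnd (G + H) → LeftDeadEnd H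
LeftDeadEnd-+ʳ G H l J s = noLeftOpts-+ʳ G J (l (G + J) (subposition-+ʳ G s))

mutual
  conj-involutive : ∀ G → conj (conj G) ≡ G
  conj-involutive ⟨ L ∣ R ⟩ = cong₂ ⟨_∣_⟩ (conjs-involutive L) (conjs-involutive R)

  conjs-involutive : ∀ gs → conjs (conjs gs) ≡ gs
  conjs-involutive []       = refl
  conjs-involutive (g ∷ gs) = cong₂ _∷_ (conj-involutive g) (conjs-involutive gs)

conjs-++ : ∀ xs ys → conjs (xs ++ ys) ≡ conjs xs ++ conjs ys
conjs-++ []       ys = refl
conjs-++ (x ∷ xs) ys = cong (conj x ∷_) (conjs-++ xs ys)

mutual
  conj-+ : ∀ G H → conj (G + H) ≡ conj G + conj H
  conj-+ G@(⟨ GL ∣ GR ⟩) H@(⟨ HL ∣ HR ⟩) = cong₂ ⟨_∣_⟩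
    (trans (conjs-++ (addL GR H) (addR G HR)) (cong₂ _++_ (conjs-addL GR H) (conjs-addR G HR)))
    (trans (conjs-++ (addL GL H) (addR G HL)) (cong₂ _++_ (conjs-addL GL H) (conjs-addR G HL)))

  conjs-addL : ∀ gs H → conjs (addL gs H) ≡ addL (conjs gs) (conj H)
  conjs-addL []       H = refl
  conjs-addL (g ∷ gs) H = cong₂ _∷_ (conj-+ g H) (conjs-addL gs H)

  conjs-addR : ∀ G hs → conjs (addR G hs) ≡ addR (conj G) (conjs hs)
  conjs-addR G []       = refl
  conjs-addR G (h ∷ hs) = cong₂ _∷_ (conj-+ G h) (conjs-addR G hs)

conjs≡map : ∀ gs → conjs gs ≡ map conj gs
conjs≡map []       = refl
conjs≡map (g ∷ gs) = cong (conj g ∷_) (conjs≡map gs)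

∈-conjs⁻ : ∀ {x} gs → x ∈ conjs gs → ∃ λ g → g ∈ gs × x ≡ conj g
∈-conjs⁻ gs x∈ = ∈-map⁻ conj (subst (_ ∈_) (conjs≡map gs) x∈)

subposition-conj⁻ : ∀ {K} G → Subposition K (conj G) → ∃ λ K′ → Subposition K′ G × K ≡ conj K′
subposition-conj⁻ G s = go s G refl
  where
  go : ∀ {K J} → Subposition K J → ∀ G → J ≡ conj G → ∃ λ K′ → Subposition K′ G × K ≡ conj K′
  go here G eq = G , here , eq
  go (there s (leftOpt J∈)) ⟨ GL ∣ GR ⟩ refl =
    let g , g∈ , eq = ∈-conjs⁻ GR J∈ ; K′ , s′ , eq′ = go s g eq in K′ , there s′ (rightOpt g∈) , eq′
  go (there s (rightOpt J∈)) ⟨ GL ∣ GR ⟩ refl =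
    let g , g∈ , eq = ∈-conjs⁻ GL J∈ ; K′ , s′ , eq′ = go s g eq in K′ , there s′ (leftOpt g∈) , eq′

conj-fixed : ∀ K → leftOpts K ≡ [] → leftOpts (conj K) ≡ [] → conj K ≡ K
conj-fixed ⟨ [] ∣ [] ⟩ _ _ = refl

Covers : List Game → List Game → Set
Covers xs ys = All (λ x → Any (λ y → x ≅ y) ys) xs

CoveredBy : List Game → List Game → Set
CoveredBy xs ys = All (λ y → Any (λ x → x ≅ y) xs) ys

mutual
  conj-≅ : ∀ {G H} → G ≅ H → conj G ≅ conj H
  conj-≅ (iso L⊆ L⊇ R⊆ R⊇) = iso (conjs-Covers R⊆) (conjs-CoveredBy R⊇) (conjs-Covers L⊆) (conjs-CoveredBy L⊇)

  conjs-Covers : ∀ {xs ys} → Covers xs ys → Covers (conjs xs) (conjs ys)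
  conjs-Covers []       = []
  conjs-Covers (p ∷ ps) = conjs-Any-≅ˡ p ∷ conjs-Covers ps

  conjs-Any-≅ˡ : ∀ {x ys} → Any (λ y → x ≅ y) ys → Any (λ y → conj x ≅ y) (conjs ys)
  conjs-Any-≅ˡ (here p)  = here (conj-≅ p)
  conjs-Any-≅ˡ (there p) = there (conjs-Any-≅ˡ p)

  conjs-CoveredBy : ∀ {xs ys} → CoveredBy xs ys → CoveredBy (conjs xs) (conjs ys)
  conjs-CoveredBy []       = []
  conjs-CoveredBy (p ∷ ps) = conjs-Any-≅ʳ p ∷ conjs-CoveredBy ps

  conjs-Any-≅ʳ : ∀ {y xs} → Any (λ x → x ≅ y) xs → Any (λ x → x ≅ conj y) (conjs xs)
  conjs-Any-≅ʳ (here p)  = here (conj-≅ p)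
  conjs-Any-≅ʳ (there p) = there (conjs-Any-≅ʳ p)

isOption-≅ˡ : ∀ {G H J} → G ≅ H → IsOption J G → ∃ λ J′ → IsOption J′ H × J ≅ J′
isOption-≅ˡ (iso L⊆ _ _ _) (leftOpt J∈)  = let J′ , J′∈ , J≅ = find (lookup L⊆ J∈) in J′ , leftOpt J′∈ , J≅
isOption-≅ˡ (iso _ _ R⊆ _) (rightOpt J∈) = let J′ , J′∈ , J≅ = find (lookup R⊆ J∈) in J′ , rightOpt J′∈ , J≅

isOption-≅ʳ : ∀ {G H J} → G ≅ H → IsOption J H → ∃ λ J′ → IsOption J′ G × J′ ≅ J
isOption-≅ʳ (iso _ L⊇ _ _) (leftOpt J∈)  = let J′ , J′∈ , J≅ = find (lookup L⊇ J∈) in J′ , leftOpt J′∈ , J≅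
isOption-≅ʳ (iso _ _ _ R⊇) (rightOpt J∈) = let J′ , J′∈ , J≅ = find (lookup R⊇ J∈) in J′ , rightOpt J′∈ , J≅

subposition-≅ˡ : ∀ {G H J} → G ≅ H → Subposition J G → ∃ λ J′ → Subposition J′ H × J ≅ J′
subposition-≅ˡ G≅H here        = _ , here , G≅H
subposition-≅ˡ G≅H (there s o) =
  let K′ , o′ , K≅ = isOption-≅ˡ G≅H o ; J′ , s′ , J≅ = subposition-≅ˡ K≅ s in J′ , there s′ o′ , J≅

subposition-≅ʳ : ∀ {G H J} → G ≅ H → Subposition J H → ∃ λ J′ → Subposition J′ G × J′ ≅ J
subposition-≅ʳ G≅H here        = _ , here , G≅H
subposition-≅ʳ G≅H (there s o) =
  let K′ , o′ , K≅ = isOption-≅ʳ G≅H o ; J′ , s′ , J≅ = subposition-≅ʳ K≅ s in J′ , there s′ o′ , J≅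

noLeftOpts-≅ : ∀ {G H} → G ≅ H → leftOpts H ≡ [] → leftOpts G ≡ []
noLeftOpts-≅ (iso [] _ _ _) _ = refl
noLeftOpts-≅ (iso (() ∷ _) _ _ _) refl

LeftDeadEnd-≅ : ∀ {G H} → G ≅ H → LeftDeadEnd H → LeftDeadEnd G
LeftDeadEnd-≅ G≅H l J s = let J′ , s′ , J≅ = subposition-≅ˡ G≅H s in noLeftOpts-≅ J≅ (l J′ s′)

OptionClosed⇒SubpositionClosed : ∀ {ℓ} {P : Game → Set ℓ} → OptionClosed P →
  ∀ {K G} → Subposition K G → P G → P K
OptionClosed⇒SubpositionClosed closed here        = λ p → p
OptionClosed⇒SubpositionClosed closed (there s o) = λ p → OptionClosed⇒SubpositionClosed closed s (closed o p)

Hereditary : (Game → Set) → Game → Set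
Hereditary P G = ∀ K → Subposition K G → P K

Hereditary-optionClosed : ∀ P → OptionClosed (Hereditary P)
Hereditary-optionClosed P o h K s = h K (there s o)

module _ (A : Game → Set) where

  DeadEndsIn : Game → Set
  DeadEndsIn K = (LeftDeadEnd K → A K) × (LeftDeadEnd (conj K) → A (conj K))

  𝒰 : Game → Set
  𝒰 = Hereditary DeadEndsIn

  𝒰-isoClosed : IsoClosed A → IsoClosed 𝒰
  𝒰-isoClosed isoA G≅H u K s =
    let K′ , s′ , K′≅K = subposition-≅ʳ G≅H s ; inA , conjInA = u K′ s′ in
    (λ l → isoA K′≅K (inA (LeftDeadEnd-≅ K′≅K l))) ,
    (λ l → isoA (conj-≅ K′≅K) (conjInA (LeftDeadEnd-≅ (conj-≅ K′≅K) l)))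

  𝒰-sumClosed : SumClosed A → SumClosed 𝒰
  𝒰-sumClosed sumA {G} {H} uG uH K s with subposition-+⁻ G H s
  ... | G′ , H′ , sG , sH , refl = sumInA , conjSumInA
    where
    sumInA : LeftDeadEnd (G′ + H′) → A (G′ + H′)
    sumInA l = sumA (proj₁ (uG G′ sG) (LeftDeadEnd-+ˡ G′ H′ l)) (proj₁ (uH H′ sH) (LeftDeadEnd-+ʳ G′ H′ l))

    conjSumInA : LeftDeadEnd (conj (G′ + H′)) → A (conj (G′ + H′))
    conjSumInA l rewrite conj-+ G′ H′ =
      sumA (proj₂ (uG G′ sG) (LeftDeadEnd-+ˡ (conj G′) (conj H′) l))
           (proj₂ (uH H′ sH) (LeftDeadEnd-+ʳ (conj G′) (conj H′) l))

  𝒰-conjClosed : ConjClosed 𝒰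
  𝒰-conjClosed {G} u K s with subposition-conj⁻ G s
  ... | K′ , s′ , refl = proj₂ (u K′ s′) , conjConjInA
    where
    conjConjInA : LeftDeadEnd (conj (conj K′)) → A (conj (conj K′))
    conjConjInA rewrite conj-involutive K′ = proj₁ (u K′ s′)

  -- {S | T} and its conjugate have Left options, so only the proper subpositions need checking.
  𝒰-formClosed : FormClosed 𝒰
  𝒰-formClosed (S ∷⁺ _) (T ∷⁺ _) uS uT K here = (λ l → hasLeftOpt (l _ here)) , (λ l → hasLeftOpt (l _ here))
    where
    hasLeftOpt : ∀ {B : Set} {x : Game} {xs : List Game} → x ∷ xs ≡ [] → B
    hasLeftOpt ()
  𝒰-formClosed (_ ∷⁺ _) (_ ∷⁺ _) uS uT K (there s (leftOpt J∈))  = lookup uS J∈ K s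
  𝒰-formClosed (_ ∷⁺ _) (_ ∷⁺ _) uS uT K (there s (rightOpt J∈)) = lookup uT J∈ K s

  𝒰-isUniverse : IsoClosed A → SumClosed A → IsUniverse 𝒰
  𝒰-isUniverse isoA sumA =
    𝒰-isoClosed isoA , Hereditary-optionClosed DeadEndsIn , 𝒰-sumClosed sumA , 𝒰-conjClosed , 𝒰-formClosed

  -- A conjugate Left dead-end inside A has no options at all, so it is its own conjugate.
  ⊆𝒰 : OptionClosed A → (∀ G → A G → LeftDeadEnd G) → ∀ {G} → A G → 𝒰 G
  ⊆𝒰 optA deadA aG K s = (λ _ → aK) , λ l → subst A (sym (conj-fixed K (deadA K aK K here) (l _ here))) aK
    where
    aK : A K
    aK = OptionClosed⇒SubpositionClosed optA s aG

proposition2p6 : (A : Game → Set) → IsoClosed A → SimplyClosed A →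
                 (∀ G → A G → LeftDeadEnd G) →
                 ∀ G → ((D A G × LeftDeadEnd G) → A G) × (A G → (D A G × LeftDeadEnd G))
proposition2p6 A isoA (optA , sumA) deadA G = D∩L⊆A , A⊆D∩L
  where
  D∩L⊆A : D A G × LeftDeadEnd G → A G
  D∩L⊆A (d , l) = proj₁ (d (𝒰 A) (𝒰-isUniverse A isoA sumA) (⊆𝒰 A optA deadA) G here) l

  A⊆D∩L : A G → D A G × LeftDeadEnd G
  A⊆D∩L aG = (λ U _ A⊆U → A⊆U aG) , deadA G aG
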